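{- Let $M$ be an integer matrix and let $S$ be a minimal torsion cocycle of $M$. Then $\operatorname{rank}_{\mathbb{Q}}(M_S) = |S|$. Moreover, $M_S$ has no row in which $|S|-1$ entries are equal to $0$ and the remaining entry is equal to $1$ or to $-1$.
   Context: For a matrix $M$ and a subset $S$ of its columns, $M_S$ is the submatrix consisting of the columns in $S$. A subset $S$ of the columns of an integer matrix $M$ is a torsion cocycle if there exists a prime $q$ with $\operatorname{rank}_{\mathbb{Q}}(M_S) > \operatorname{rank}_{\mathbb{Z}/q\mathbb{Z}}(M_S)$. A minimal torsion cocycle is an inclusion-minimal set of columns that is a torsion cocycle. -}

module Defs where

open import Data.Nat as ℕ using (ℕ; zero; suc; _<_; _≤_)
open import Data.Nat.Primality using (Prime)
open import Data.Integer as ℤ using (ℤ; +_; -[1+_])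
open import Data.Integer.Divisibility as ℤD using ()
open import Data.Rational as ℚ using (ℚ; 0ℚ)
open import Data.Fin using (Fin; zero; suc)
open import Data.Fin.Subset using (Subset; _∈_; _∉_; _⊆_; _⊂_; ∣_∣)
open import Data.Product using (Σ; ∃; _×_; _,_)
open import Data.Sum using (_⊎_)
open import Relation.Binary.PropositionalEquality using (_≡_; _≢_)
open import Relation.Nullary using (¬_)

Matrix : ℕ → ℕ → Set
Matrix m n = Fin m → Fin n → ℤ

sumℚ : ∀ {n} → (Fin n → ℚ) → ℚ
sumℚ {zero}  f = 0ℚ
sumℚ {suc n} f = f zero ℚ.+ sumℚ (λ j → f (suc j))

sumℤ : ∀ {n} → (Fin n → ℤ) → ℤ
sumℤ {zero}  f = + 0
sumℤ {suc n} f = f zero ℤ.+ sumℤ (λ j → f (suc j))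

toℚ : ℤ → ℚ
toℚ x = x ℚ./ 1

IndepℚCols : ∀ {m n} → Matrix m n → Subset n → Set
IndepℚCols {m} {n} M T =
  (c : Fin n → ℚ) → (∀ j → j ∉ T → c j ≡ 0ℚ) →
  (∀ (i : Fin m) → sumℚ (λ j → c j ℚ.* toℚ (M i j)) ≡ 0ℚ) →
  ∀ j → c j ≡ 0ℚ

-- The columns in T are linearly independent over ℤ/qℤ, elements of ℤ/qℤ
-- being represented by integers (equality = congruence mod q).
IndepModCols : ∀ {m n} → ℕ → Matrix m n → Subset n → Set
IndepModCols {m} {n} q M T =
  (c : Fin n → ℤ) → (∀ j → j ∉ T → c j ≡ + 0) →
  (∀ (i : Fin m) → (+ q) ℤD.∣ sumℤ (λ j → c j ℤ.* M i j)) →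
  ∀ j → (+ q) ℤD.∣ c j

RankℚIs : ∀ {m n} → Matrix m n → Subset n → ℕ → Set
RankℚIs M S r =
  (Σ (Subset _) λ T → T ⊆ S × ∣ T ∣ ≡ r × IndepℚCols M T) ×
  (∀ T → T ⊆ S → IndepℚCols M T → ∣ T ∣ ≤ r)

RankModIs : ∀ {m n} → ℕ → Matrix m n → Subset n → ℕ → Set
RankModIs q M S r =
  (Σ (Subset _) λ T → T ⊆ S × ∣ T ∣ ≡ r × IndepModCols q M T) ×
  (∀ T → T ⊆ S → IndepModCols q M T → ∣ T ∣ ≤ r)

TorsionCocycle : ∀ {m n} → Matrix m n → Subset n → Set
TorsionCocycle M S =
  Σ ℕ λ q → Prime q × Σ ℕ λ r → Σ ℕ λ s →
    RankℚIs M S r × RankModIs q M S s × s < r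

MinimalTorsionCocycle : ∀ {m n} → Matrix m n → Subset n → Set
MinimalTorsionCocycle M S =
  TorsionCocycle M S × (∀ S′ → S′ ⊂ S → ¬ TorsionCocycle M S′)

UnitRow : ∀ {m n} → Matrix m n → Subset n → Fin m → Set
UnitRow M S i =
  Σ (Fin _) λ j → j ∈ S × (M i j ≡ + 1 ⊎ M i j ≡ -[1+ 0 ]) ×
    (∀ k → k ∈ S → k ≢ j → M i k ≡ + 0)

-- Let q witness the torsion of S, with rank_ℚ(M_S) = r > s = rank_q(M_S).
-- Any proper subset T of S that is ℚ-independent and has |T| = r would again
-- be a torsion cocycle (its q-rank is at most s), so minimality forces the
-- columns of S to be ℚ-independent.  If some row of M_S were a unit vector
-- e_j up to sign, that row would let every q-independent subset of S - j be
-- extended by j, so rank_q(M_(S-j)) ≤ s - 1 < |S| - 1 = rank_ℚ(M_(S-j)):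
-- S - j would be a smaller torsion cocycle.  Ranks are maxima over subsets
-- whose independence is not decidable, so they exist only up to double
-- negation, which suffices as every argument ends in a contradiction.
module Submission where

open import Defs
open import Data.Nat using (ℕ)
open import Data.Fin using (Fin)
open import Data.Fin.Subset using (Subset; ∣_∣)
open import Data.Product using (_×_; ∃)
open import Relation.Nullary using (¬_)

open import Data.Nat using (zero; suc; _≤_; _<_; s<s⁻¹)
open import Data.Nat.Properties using (≤-pred; ≤∧≢⇒<; ≤-<-trans; module ≤-Reasoning)
open import Data.Nat.Primality using (Prime)
open import Data.Nat.Divisibility using (_∣0)
open import Data.Fin using (zero; suc; _≟_)
open import Data.Fin.Subset
  using (_∈_; _∉_; _⊆_; _⊂_; ⊥; _∪_; ⁅_⁆; _-_; inside; outside)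
open import Data.Fin.Subset.Properties
  using (_∈?_; ∉⊥; ⊥⊆; ∣⊥∣≡0; ⊆-refl; ⊆-trans; p⊆q⇒∣p∣≤∣q∣; p⊂q⇒∣p∣<∣q∣;
         p⊆p∪q; x∈p∪q⁺; x∈p∪q⁻; x∈⁅x⁆; x∈⁅y⁆⇒x≡y; p─⊥≡p; p─q⊆p; x∈p⇒p-x⊂p)
open import Data.Vec using (_∷_; here; there)
open import Data.Vec.Functional using (updateAt)
open import Data.Vec.Functional.Properties using (updateAt-updates; updateAt-minimal)
open import Data.Integer using (ℤ; +_; -[1+_]; _+_; _*_)
open import Data.Integer.Properties
  using (+-comm; +-assoc; +-identityˡ; *-assoc; *-identityʳ; *-zeroˡ; *-zeroʳ)
import Data.Integer.Divisibility as Unsigned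
open import Data.Integer.Divisibility.Signed using (_∣_; ∣ᵤ⇒∣; ∣⇒∣ᵤ; ∣m⇒∣m*n; ∣m+n∣n⇒∣m)
open import Data.Product using (Σ; _,_)
open import Data.Sum using (_⊎_; inj₁; inj₂)
open import Data.Empty using (⊥-elim)
open import Function using (const)
open import Relation.Nullary using (yes; no)
open import Relation.Nullary.Decidable using (¬¬-excluded-middle)
open import Relation.Binary.PropositionalEquality
  using (_≡_; _≢_; refl; sym; trans; cong; cong₂; subst; module ≡-Reasoning)

⊆∧⊄⇒⊇ : ∀ {n} {T S : Subset n} → T ⊆ S → ¬ (T ⊂ S) → S ⊆ T
⊆∧⊄⇒⊇ {T = T} T⊆S T⊄S {x} x∈S with x ∈? T
... | yes x∈T = x∈T
... | no  x∉T = ⊥-elim (T⊄S (T⊆S , x , x∈S , x∉T))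

x∉p-x : ∀ {n} (x : Fin n) (p : Subset n) → x ∉ p - x
x∉p-x zero    (s ∷ p) ()
x∉p-x (suc x) (s ∷ p) (there x∈p-x) = x∉p-x x p x∈p-x

x∈p-y⇒x≢y : ∀ {n} {x y : Fin n} {p : Subset n} → x ∈ p - y → x ≢ y
x∈p-y⇒x≢y {p = p} x∈p-x refl = x∉p-x _ p x∈p-x

x∈p⇒∣p∣≡1+∣p-x∣ : ∀ {n} {x : Fin n} {p : Subset n} → x ∈ p → ∣ p ∣ ≡ suc ∣ p - x ∣
x∈p⇒∣p∣≡1+∣p-x∣ {x = zero}  {inside  ∷ p} here          = cong (λ t → suc ∣ t ∣) (sym (p─⊥≡p p))
x∈p⇒∣p∣≡1+∣p-x∣ {x = suc x} {inside  ∷ p} (there x∈p) = cong suc (x∈p⇒∣p∣≡1+∣p-x∣ x∈p)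
x∈p⇒∣p∣≡1+∣p-x∣ {x = suc x} {outside ∷ p} (there x∈p) = x∈p⇒∣p∣≡1+∣p-x∣ x∈p

x∉p∧x≢y⇒x∉p∪⁅y⁆ : ∀ {n} {x y : Fin n} {p : Subset n} → x ∉ p → x ≢ y → x ∉ p ∪ ⁅ y ⁆
x∉p∧x≢y⇒x∉p∪⁅y⁆ {y = y} {p} x∉p x≢y x∈p∪⁅y⁆ with x∈p∪q⁻ p ⁅ y ⁆ x∈p∪⁅y⁆
... | inj₁ x∈p    = x∉p x∈p
... | inj₂ x∈⁅y⁆ = x≢y (x∈⁅y⁆⇒x≡y y x∈⁅y⁆)

p⊆q∧x∈q⇒p∪⁅x⁆⊆q : ∀ {n} {x : Fin n} {p q : Subset n} → p ⊆ q → x ∈ q → p ∪ ⁅ x ⁆ ⊆ q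
p⊆q∧x∈q⇒p∪⁅x⁆⊆q {x = x} {p} p⊆q x∈q y∈p∪⁅x⁆ with x∈p∪q⁻ p ⁅ x ⁆ y∈p∪⁅x⁆
... | inj₁ y∈p    = p⊆q y∈p
... | inj₂ y∈⁅x⁆ = subst (_∈ _) (sym (x∈⁅y⁆⇒x≡y x y∈⁅x⁆)) x∈q

x∉p⇒∣p∣<∣p∪⁅x⁆∣ : ∀ {n} {x : Fin n} {p : Subset n} → x ∉ p → ∣ p ∣ < ∣ p ∪ ⁅ x ⁆ ∣
x∉p⇒∣p∣<∣p∪⁅x⁆∣ {x = x} {p} x∉p =
  p⊂q⇒∣p∣<∣q∣ (p⊆p∪q ⁅ x ⁆ , x , x∈p∪q⁺ (inj₂ (x∈⁅x⁆ x)) , x∉p)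

MaximumSizeIs : ∀ {n} → (Subset n → Set) → Subset n → ℕ → Set
MaximumSizeIs P S r =
  (Σ (Subset _) λ T → T ⊆ S × ∣ T ∣ ≡ r × P T) × (∀ T → T ⊆ S → P T → ∣ T ∣ ≤ r)

maximumSize-self : ∀ {n} {P : Subset n → Set} {S} → P S → MaximumSizeIs P S ∣ S ∣
maximumSize-self PS = (_ , ⊆-refl , refl , PS) , λ T T⊆S _ → p⊆q⇒∣p∣≤∣q∣ T⊆S

maximumSize≤size : ∀ {n} {P : Subset n → Set} {S r} → MaximumSizeIs P S r → r ≤ ∣ S ∣
maximumSize≤size ((T , T⊆S , refl , _) , _) = p⊆q⇒∣p∣≤∣q∣ T⊆S

maximumSize-mono : ∀ {n} {P : Subset n → Set} {T S a b} →
  T ⊆ S → MaximumSizeIs P T a → MaximumSizeIs P S b → a ≤ b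
maximumSize-mono T⊆S ((U , U⊆T , refl , PU) , _) (_ , maximal) = maximal U (⊆-trans U⊆T T⊆S) PU

¬¬-maximumSize : ∀ {n} {P : Subset n → Set} {S} → P ⊥ → ¬ ¬ ∃ (MaximumSizeIs P S)
¬¬-maximumSize {n} {P} {S} P⊥ = descend ∣ S ∣ (λ T T⊆S _ → p⊆q⇒∣p∣≤∣q∣ T⊆S)
  where
  descend : ∀ b → (∀ T → T ⊆ S → P T → ∣ T ∣ ≤ b) → ¬ ¬ ∃ (MaximumSizeIs P S)
  descend zero    bounded ¬max = ¬max (0 , (⊥ , ⊥⊆ , ∣⊥∣≡0 n , P⊥) , bounded)
  descend (suc b) bounded ¬max = ¬¬-excluded-middle λ where
    (yes attained) → ¬max (suc b , attained , bounded)
    (no unattained) → descend b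
      (λ T T⊆S PT → ≤-pred (≤∧≢⇒< (bounded T T⊆S PT) λ ∣T∣≡1+b → unattained (T , T⊆S , ∣T∣≡1+b , PT)))
      ¬max

sumℤ-cong : ∀ {n} {f g : Fin n → ℤ} → (∀ k → f k ≡ g k) → sumℤ f ≡ sumℤ g
sumℤ-cong {zero}  f≗g = refl
sumℤ-cong {suc n} f≗g = cong₂ _+_ (f≗g zero) (sumℤ-cong (λ k → f≗g (suc k)))

sumℤ-zero : ∀ n → sumℤ {n} (const (+ 0)) ≡ + 0
sumℤ-zero zero    = refl
sumℤ-zero (suc n) = trans (+-identityˡ _) (sumℤ-zero n)

sumℤ-split : ∀ {n} (f g : Fin n → ℤ) (j : Fin n) →
  (∀ k → k ≢ j → f k ≡ g k) → g j ≡ + 0 → sumℤ f ≡ sumℤ g + f j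
sumℤ-split {suc n} f g zero f≡g gj≡0 = begin
  f zero + sumℤ (λ k → f (suc k))            ≡⟨ cong (λ x → f zero + x) (sumℤ-cong λ k → f≡g (suc k) λ ()) ⟩
  f zero + sumℤ (λ k → g (suc k))            ≡⟨ +-comm (f zero) _ ⟩
  sumℤ (λ k → g (suc k)) + f zero            ≡⟨ cong (λ x → x + f zero) (sym (+-identityˡ (sumℤ λ k → g (suc k)))) ⟩
  (+ 0 + sumℤ (λ k → g (suc k))) + f zero    ≡⟨ cong (λ x → (x + sumℤ (λ k → g (suc k))) + f zero) (sym gj≡0) ⟩
  (g zero + sumℤ (λ k → g (suc k))) + f zero ∎
  where open ≡-Reasoning
sumℤ-split {suc n} f g (suc j) f≡g gj≡0 = begin
  f zero + sumℤ (λ k → f (suc k))                  ≡⟨ cong₂ _+_ (f≡g zero λ ()) (sumℤ-split _ _ j f≡g′ gj≡0) ⟩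
  g zero + (sumℤ (λ k → g (suc k)) + f (suc j))    ≡⟨ sym (+-assoc (g zero) _ _) ⟩
  (g zero + sumℤ (λ k → g (suc k))) + f (suc j)    ∎
  where
  open ≡-Reasoning
  f≡g′ : ∀ k → k ≢ j → f (suc k) ≡ g (suc k)
  f≡g′ k k≢j = f≡g (suc k) λ { refl → k≢j refl }

sumℤ-single : ∀ {n} (f : Fin n → ℤ) (j : Fin n) → (∀ k → k ≢ j → f k ≡ + 0) → sumℤ f ≡ f j
sumℤ-single {n} f j f≡0 = begin
  sumℤ f                       ≡⟨ sumℤ-split f (const (+ 0)) j f≡0 refl ⟩
  sumℤ {n} (const (+ 0)) + f j ≡⟨ cong (_+ f j) (sumℤ-zero n) ⟩
  + 0 + f j                    ≡⟨ +-identityˡ (f j) ⟩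
  f j                          ∎
  where open ≡-Reasoning

IndepℚCols-antimono : ∀ {m n} {M : Matrix m n} {T S : Subset n} →
  T ⊆ S → IndepℚCols M S → IndepℚCols M T
IndepℚCols-antimono T⊆S indS c c-supp = indS c (λ k k∉S → c-supp k λ k∈T → k∉S (T⊆S k∈T))

IndepModCols-⊥ : ∀ {m n} (q : ℕ) (M : Matrix m n) → IndepModCols q M ⊥
IndepModCols-⊥ q M c c-supp _ k = subst (Unsigned._∣_ (+ q)) (sym (c-supp k ∉⊥)) (q ∣0)

±1*±1≡1 : ∀ {u} → u ≡ + 1 ⊎ u ≡ -[1+ 0 ] → u * u ≡ + 1
±1*±1≡1 (inj₁ refl) = refl
±1*±1≡1 (inj₂ refl) = refl

∣x*±1⇒∣x : ∀ {k x u} → u ≡ + 1 ⊎ u ≡ -[1+ 0 ] → k ∣ x * u → k ∣ x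
∣x*±1⇒∣x {k} {x} {u} u≡±1 k∣x*u = subst (k ∣_) x*u*u≡x (∣m⇒∣m*n u k∣x*u)
  where
  open ≡-Reasoning
  x*u*u≡x : x * u * u ≡ x
  x*u*u≡x = begin
    x * u * u   ≡⟨ *-assoc x u u ⟩
    x * (u * u) ≡⟨ cong (x *_) (±1*±1≡1 u≡±1) ⟩
    x * + 1     ≡⟨ *-identityʳ x ⟩
    x           ∎

-- Row i forces q ∣ c j for any combination c vanishing mod q; subtracting
-- the j-th column then leaves a combination supported on W.
±1-row-extends-IndepModCols : ∀ {m n q} {M : Matrix m n} {W : Subset n} (i : Fin m) (j : Fin n) →
  (M i j ≡ + 1 ⊎ M i j ≡ -[1+ 0 ]) → (∀ k → k ∈ W → M i k ≡ + 0) →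
  IndepModCols q M W → IndepModCols q M (W ∪ ⁅ j ⁆)
±1-row-extends-IndepModCols {q = q} {M} {W} i j M[i,j]≡±1 M[i,W]≡0 indW c c-supp c-rows = q∣c
  where
  only-j : ∀ k → k ≢ j → c k * M i k ≡ + 0
  only-j k k≢j with k ∈? W
  ... | yes k∈W = trans (cong (c k *_) (M[i,W]≡0 k k∈W)) (*-zeroʳ (c k))
  ... | no  k∉W = trans (cong (_* M i k) (c-supp k (x∉p∧x≢y⇒x∉p∪⁅y⁆ k∉W k≢j))) (*-zeroˡ (M i k))

  q∣c[j] : + q ∣ c j
  q∣c[j] = ∣x*±1⇒∣x M[i,j]≡±1
    (subst (+ q ∣_) (sumℤ-single (λ k → c k * M i k) j only-j) (∣ᵤ⇒∣ (c-rows i)))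

  c′ : Fin _ → ℤ
  c′ = updateAt c j (const (+ 0))

  c′-supp : ∀ k → k ∉ W → c′ k ≡ + 0
  c′-supp k k∉W with k ≟ j
  ... | yes refl = updateAt-updates j c
  ... | no  k≢j = trans (updateAt-minimal k j c k≢j) (c-supp k (x∉p∧x≢y⇒x∉p∪⁅y⁆ k∉W k≢j))

  c′-rows : ∀ i′ → Unsigned._∣_ (+ q) (sumℤ λ k → c′ k * M i′ k)
  c′-rows i′ = ∣⇒∣ᵤ (∣m+n∣n⇒∣m {m = sumℤ λ k → c′ k * M i′ k}
    (subst (+ q ∣_) split (∣ᵤ⇒∣ (c-rows i′))) (∣m⇒∣m*n (M i′ j) q∣c[j]))
    where
    split : sumℤ (λ k → c k * M i′ k) ≡ sumℤ (λ k → c′ k * M i′ k) + c j * M i′ j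
    split = sumℤ-split _ _ j
      (λ k k≢j → cong (_* M i′ k) (sym (updateAt-minimal k j c k≢j)))
      (trans (cong (_* M i′ j) (updateAt-updates j c)) (*-zeroˡ (M i′ j)))

  q∣c : ∀ k → Unsigned._∣_ (+ q) (c k)
  q∣c k with k ≟ j
  ... | yes refl = ∣⇒∣ᵤ q∣c[j]
  ... | no  k≢j = subst (Unsigned._∣_ (+ q)) (updateAt-minimal k j c k≢j) (indW c′ c′-supp c′-rows k)

¬¬-torsionCocycle : ∀ {m n q} {M : Matrix m n} {T : Subset n} → Prime q → IndepℚCols M T →
  (∀ {s} → RankModIs q M T s → s < ∣ T ∣) → ¬ ¬ TorsionCocycle M T
¬¬-torsionCocycle {q = q} {M} {T} q-prime indT deficient ¬torsion =
  ¬¬-maximumSize (IndepModCols-⊥ q M) λ (s , rank-mod-T) →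
    ¬torsion (q , q-prime , ∣ T ∣ , s , maximumSize-self indT , rank-mod-T , deficient rank-mod-T)

minimal⇒IndepℚCols : ∀ {m n} {M : Matrix m n} {S : Subset n} → MinimalTorsionCocycle M S → IndepℚCols M S
minimal⇒IndepℚCols {M = M} {S}
  ((q , q-prime , _ , s , ((T , T⊆S , refl , indT) , _) , rank-mod-S , s<∣T∣) , minimal) =
  IndepℚCols-antimono {M = M} (⊆∧⊄⇒⊇ T⊆S T⊄S) indT
  where
  T⊄S : ¬ (T ⊂ S)
  T⊄S T⊂S = ¬¬-torsionCocycle q-prime indT
    (λ rank-mod-T → ≤-<-trans (maximumSize-mono T⊆S rank-mod-T rank-mod-S) s<∣T∣)
    (minimal T T⊂S)

minimal⇒¬±1-row : ∀ {m n} {M : Matrix m n} {S : Subset n} → MinimalTorsionCocycle M S → ¬ ∃ (UnitRow M S)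
minimal⇒¬±1-row {M = M} {S}
  cocycle@((q , q-prime , r , s , rank-ℚ-S , (_ , mod-maximal) , s<r) , minimal)
  (i , j , j∈S , M[i,j]≡±1 , M[i,S-j]≡0) =
  ¬¬-torsionCocycle q-prime (IndepℚCols-antimono {M = M} (p─q⊆p S ⁅ j ⁆) (minimal⇒IndepℚCols cocycle))
    deficient (minimal (S - j) (x∈p⇒p-x⊂p j∈S))
  where
  open ≤-Reasoning
  deficient : ∀ {s′} → RankModIs q M (S - j) s′ → s′ < ∣ S - j ∣
  deficient ((W , W⊆S-j , refl , indW) , _) = s<s⁻¹ (begin-strict
    suc ∣ W ∣       ≤⟨ x∉p⇒∣p∣<∣p∪⁅x⁆∣ (λ j∈W → x∉p-x j S (W⊆S-j j∈W)) ⟩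
    ∣ W ∪ ⁅ j ⁆ ∣   ≤⟨ mod-maximal (W ∪ ⁅ j ⁆) (p⊆q∧x∈q⇒p∪⁅x⁆⊆q W⊆S j∈S) indW∪j ⟩
    s               <⟨ s<r ⟩
    r               ≤⟨ maximumSize≤size rank-ℚ-S ⟩
    ∣ S ∣           ≡⟨ x∈p⇒∣p∣≡1+∣p-x∣ j∈S ⟩
    suc ∣ S - j ∣   ∎)
    where
    W⊆S : W ⊆ S
    W⊆S = ⊆-trans W⊆S-j (p─q⊆p S ⁅ j ⁆)
    indW∪j : IndepModCols q M (W ∪ ⁅ j ⁆)
    indW∪j = ±1-row-extends-IndepModCols i j M[i,j]≡±1
      (λ k k∈W → M[i,S-j]≡0 k (W⊆S k∈W) (x∈p-y⇒x≢y (W⊆S-j k∈W))) indW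

claim3p2 : ∀ {m n} (M : Matrix m n) (S : Subset n) →
    MinimalTorsionCocycle M S →
    RankℚIs M S ∣ S ∣ × ¬ (∃ λ (i : Fin m) → UnitRow M S i)
claim3p2 M S cocycle = maximumSize-self (minimal⇒IndepℚCols cocycle) , minimal⇒¬±1-row cocycle
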